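{- In the distributive $\lambda$-calculus $\lambda^{\#}$ there is no infinite reduction sequence $t_0\to_{\#}t_1\to_{\#}t_2\to_{\#}\cdots$ of correct terms.
   Context: The distributive $\lambda$-calculus $\lambda^{\#}$. Labels $\ell,\dots$; base types $\alpha,\dots$. Types $\mathcal{A}::=\alpha^\ell\mid\mathcal{M}\xrightarrow{\ell}\mathcal{A}$, $\mathcal{M}$ a finite multiset of types, $\ell$ the external label. Terms $t::=x^{\mathcal{A}}\mid\lambda^\ell x.t\mid t[s_1,\dots,s_n]$ ($n\ge 0$). Typing: $x:[\mathcal{A}]\vdash x^{\mathcal{A}}:\mathcal{A}$; from $\Gamma\oplus(x:\mathcal{M})\vdash t:\mathcal{B}$ infer $\Gamma\vdash\lambda^\ell x.t:\mathcal{M}\xrightarrow{\ell}\mathcal{B}$; from $\Gamma\vdash t:[\mathcal{B}_1..\mathcal{B}_n]\xrightarrow{\ell}\mathcal{A}$, $\Delta_i\vdash s_i:\mathcal{B}_i$ infer $\Gamma+\sum\Delta_i\vdash t[s_1..s_n]:\mathcal{A}$ (contexts: finite partial maps from variables to multisets, pointwise sum, $\oplus$ = sum of disjoint-domain contexts). A multiset of types is sequential if external labels of its members are pairwise distinct. Correct term: typable; distinct lambda occurrences carry distinct labels; every subterm has a sequential context (each $\Gamma(x)$ sequential); for every subterm with $\Gamma\vdash s:\mathcal{A}$, every subformula $\mathcal{M}\xrightarrow{\ell}\mathcal{B}$ of $\Gamma$ or $\mathcal{A}$ has $\mathcal{M}$ sequential. Substitution $t\{x:=\vec s\}$ (defined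 when the multiset of types of free occurrences of $x$ in $t$ equals that of $\vec s$) replaces each free occurrence $x^{\mathcal{A}}$ by the unique element of $\vec s$ of type $\mathcal{A}$, recursively: $x^{\mathcal{A}}\{x:=[s]\}=s$, $y^{\mathcal{A}}\{x:=[]\}=y^{\mathcal{A}}$, through lambdas (capture-avoiding), and for applications $u_0[u_1..u_m]$ by splitting $\vec s$ into a partition $(\vec s_0,\dots,\vec s_m)$ matching the types of free occurrences of $x$ in each $u_j$. The relation $\to_{\#}$ on correct terms is the closure under arbitrary contexts of $(\lambda^\ell x.t)\vec s\to_{\#}t\{x:=\vec s\}$. -}

module Defs where

open import Data.Nat using (ℕ; zero; suc; _<_; _≤_; _<ᵇ_)
open import Data.Bool using (if_then_else_)
open import Data.List using (List; []; _∷_; [_]; _++_; concat; foldr)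
open import Data.List.Relation.Binary.Permutation.Propositional using (_↭_)
open import Data.List.Relation.Unary.Unique.Propositional using (Unique)
open import Data.List.Relation.Unary.All using (All)
open import Data.Product using (Σ; _×_)
open import Data.Unit using (⊤)

-- Labels and base types are natural numbers.
--   base α ℓ   represents  α^ℓ
--   arr M ℓ B  represents  M --ℓ--> B, where the list M stands for a
--              finite multiset (considered up to _≋_ below).

data Ty : Set where
  base : (α ℓ : ℕ) → Ty
  arr  : (M : List Ty) (ℓ : ℕ) (B : Ty) → Ty

ext : Ty → ℕ
ext (base α ℓ) = ℓ
ext (arr M ℓ B) = ℓ

mutual
  data _≈ₜ_ : Ty → Ty → Set where
    base : ∀ {α ℓ} → base α ℓ ≈ₜ base α ℓ
    arr  : ∀ {M N ℓ A B} → M ≋ N → A ≈ₜ B → arr M ℓ A ≈ₜ arr N ℓ B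

  data _≋_ : List Ty → List Ty → Set where
    ≋-intro : ∀ {M M' N} → M ↭ M' → M' ≈* N → M ≋ N

  data _≈*_ : List Ty → List Ty → Set where
    []  : [] ≈* []
    _∷_ : ∀ {A B M N} → A ≈ₜ B → M ≈* N → (A ∷ M) ≈* (B ∷ N)

Sequential : List Ty → Set
Sequential M = Unique (Data.List.map ext M)

mutual
  SeqTy : Ty → Set
  SeqTy (base α ℓ) = ⊤
  SeqTy (arr M ℓ B) = Sequential M × SeqTys M × SeqTy B

  SeqTys : List Ty → Set
  SeqTys [] = ⊤
  SeqTys (A ∷ M) = SeqTy A × SeqTys M

-- Contexts (de Bruijn): entry i is the multiset Γ(i); missing entries = [].

Ctx : Set
Ctx = List (List Ty)

lookupC : Ctx → ℕ → List Ty
lookupC [] _ = []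
lookupC (M ∷ Γ) zero = M
lookupC (M ∷ Γ) (suc i) = lookupC Γ i

_≈c_ : Ctx → Ctx → Set
Γ ≈c Δ = ∀ i → lookupC Γ i ≋ lookupC Δ i

_+c_ : Ctx → Ctx → Ctx
[] +c Δ = Δ
(M ∷ Γ) +c [] = M ∷ Γ
(M ∷ Γ) +c (N ∷ Δ) = (M ++ N) ∷ (Γ +c Δ)

sumC : List Ctx → Ctx
sumC = foldr _+c_ []

single : ℕ → Ty → Ctx
single zero A = [ [ A ] ] 
single (suc i) A = [] ∷ single i A

-- Terms (de Bruijn indices; variables carry their type annotation)
--   var i A      :  x^A
--   lam ℓ t      :  λ^ℓ x. t
--   app t ss     :  t[s_1,...,s_n]

data Tm : Set where
  var : ℕ → Ty → Tm
  lam : ℕ → Tm → Tm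
  app : Tm → List Tm → Tm

mutual
  data _⊢_∶_ : Ctx → Tm → Ty → Set where
    ⊢var : ∀ {Γ i A} → Γ ≈c single i A → Γ ⊢ var i A ∶ A
    ⊢lam : ∀ {Γ M ℓ t B} → (M ∷ Γ) ⊢ t ∶ B → Γ ⊢ lam ℓ t ∶ arr M ℓ B
    ⊢app : ∀ {Γ Γ' t M ℓ A ss Bs Δs} →
           Γ ⊢ t ∶ arr M ℓ A → M ≋ Bs → Args Δs ss Bs →
           Γ' ≈c (Γ +c sumC Δs) → Γ' ⊢ app t ss ∶ A

  data Args : List Ctx → List Tm → List Ty → Set where
    []  : Args [] [] []
    _∷_ : ∀ {Δ s B Δs ss Bs} → Δ ⊢ s ∶ B → Args Δs ss Bs →
          Args (Δ ∷ Δs) (s ∷ ss) (B ∷ Bs)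

Good : Ctx → Ty → Set
Good Γ A = All (λ M → Sequential M × SeqTys M) Γ × SeqTy A

mutual
  AllJ : ∀ {Γ t A} → Γ ⊢ t ∶ A → Set
  AllJ {Γ} {_} {A} (⊢var _) = Good Γ A
  AllJ {Γ} {_} {A} (⊢lam d) = Good Γ A × AllJ d
  AllJ {Γ} {_} {A} (⊢app d _ as _) = Good Γ A × AllJ d × AllArgs as

  AllArgs : ∀ {Δs ss Bs} → Args Δs ss Bs → Set
  AllArgs [] = ⊤
  AllArgs (d ∷ as) = AllJ d × AllArgs as

mutual
  labels : Tm → List ℕ
  labels (var _ _) = []
  labels (lam ℓ t) = ℓ ∷ labels t
  labels (app t ss) = labels t ++ labelsL ss

  labelsL : List Tm → List ℕ
  labelsL [] = []
  labelsL (s ∷ ss) = labels s ++ labelsL ss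

Correct : Tm → Set
Correct t = Unique (labels t) ×
            Σ Ctx λ Γ → Σ Ty λ A → Σ (Γ ⊢ t ∶ A) AllJ

shiftVar : ℕ → ℕ → ℕ
shiftVar c i = if i <ᵇ c then i else suc i

mutual
  shift : ℕ → Tm → Tm
  shift c (var i A) = var (shiftVar c i) A
  shift c (lam ℓ t) = lam ℓ (shift (suc c) t)
  shift c (app t ss) = app (shift c t) (shifts c ss)

  shifts : ℕ → List Tm → List Tm
  shifts c [] = []
  shifts c (s ∷ ss) = shift c s ∷ shifts c ss

-- Substitution as a relation:  Sub k t ss r  means  t{k := ss} = r
-- (index k replaced, free indices above k decremented).
mutual
  data Sub : ℕ → Tm → List Tm → Tm → Set where
    sub-here : ∀ {k A A' s Γ} → Γ ⊢ s ∶ A' → A' ≈ₜ A →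
               Sub k (var k A) [ s ] s
    sub-lt   : ∀ {k j A} → j < k → Sub k (var j A) [] (var j A)
    sub-gt   : ∀ {k j A} → k ≤ j → Sub k (var (suc j) A) [] (var j A)
    sub-lam  : ∀ {k ℓ t ss r} → Sub (suc k) t (shifts 0 ss) r →
               Sub k (lam ℓ t) ss (lam ℓ r)
    sub-app  : ∀ {k u us ss s0 sss r rs} →
               ss ↭ concat (s0 ∷ sss) → Sub k u s0 r → Subs k us sss rs →
               Sub k (app u us) ss (app r rs)

  data Subs : ℕ → List Tm → List (List Tm) → List Tm → Set where
    []  : ∀ {k} → Subs k [] [] []
    _∷_ : ∀ {k u us s sss r rs} → Sub k u s r → Subs k us sss rs →
          Subs k (u ∷ us) (s ∷ sss) (r ∷ rs)

mutual
  data _⟶_ : Tm → Tm → Set where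
    β     : ∀ {ℓ t ss r} → Sub 0 t ss r → app (lam ℓ t) ss ⟶ r
    ξlam  : ∀ {ℓ t t'} → t ⟶ t' → lam ℓ t ⟶ lam ℓ t'
    ξhead : ∀ {t t' ss} → t ⟶ t' → app t ss ⟶ app t' ss
    ξarg  : ∀ {t ss ss'} → ss ⟶₁ ss' → app t ss ⟶ app t ss'

  data _⟶₁_ : List Tm → List Tm → Set where
    here  : ∀ {s s' ss} → s ⟶ s' → (s ∷ ss) ⟶₁ (s' ∷ ss)
    there : ∀ {s ss ss'} → ss ⟶₁ ss' → (s ∷ ss) ⟶₁ (s ∷ ss')

_⟶#_ : Tm → Tm → Set
t ⟶# u = Correct t × Correct u × t ⟶ u

-- Substitution is linear: each argument replaces exactly one occurrence of the
-- bound variable and shifting preserves size, so  size (t{x := ss}) ≤ size t + Σ size ss.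
-- A β-step additionally erases a λ-node and an application node, hence every
-- reduction step strictly decreases the size, and an infinite reduction sequence
-- would give an infinite descending chain in ℕ.
module Submission where

open import Defs
open import Data.Nat using (ℕ; suc; _+_; _≤_; _<_; z≤n; s≤s)
open import Data.Nat.Properties
open import Data.Nat.Induction using (<-wellFounded)
open import Data.Nat.ListAction using (sum)
open import Data.Nat.ListAction.Properties using (sum-++; sum-↭)
open import Algebra.Properties.CommutativeSemigroup +-commutativeSemigroup using (interchange)
open import Data.List using (List; []; _∷_; _++_; concat; map)
open import Data.List.Properties using (map-++)
open import Data.List.Relation.Binary.Permutation.Propositional using (_↭_)
open import Data.List.Relation.Binary.Permutation.Propositional.Properties using (map⁺)
open import Data.Product using (Σ; _×_; _,_)
open import Data.Empty using (⊥)
open import Induction.WellFounded using (Acc; acc)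
open import Relation.Nullary using (¬_)
open import Relation.Binary.PropositionalEquality using (_≡_; refl; cong; cong₂; sym; module ≡-Reasoning)
open ≡-Reasoning

mutual
  size : Tm → ℕ
  size (var _ _) = 1
  size (lam _ t) = suc (size t)
  size (app t ss) = suc (size t + sizes ss)

  sizes : List Tm → ℕ
  sizes [] = 0
  sizes (s ∷ ss) = size s + sizes ss

sizes≡sum∘map : ∀ ss → sizes ss ≡ sum (map size ss)
sizes≡sum∘map [] = refl
sizes≡sum∘map (s ∷ ss) = cong (size s +_) (sizes≡sum∘map ss)

sizes-++ : ∀ ss ts → sizes (ss ++ ts) ≡ sizes ss + sizes ts
sizes-++ ss ts = begin
  sizes (ss ++ ts)                      ≡⟨ sizes≡sum∘map (ss ++ ts) ⟩
  sum (map size (ss ++ ts))             ≡⟨ cong sum (map-++ size ss ts) ⟩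
  sum (map size ss ++ map size ts)      ≡⟨ sum-++ (map size ss) (map size ts) ⟩
  sum (map size ss) + sum (map size ts) ≡⟨ sym (cong₂ _+_ (sizes≡sum∘map ss) (sizes≡sum∘map ts)) ⟩
  sizes ss + sizes ts                   ∎

sizes-↭ : ∀ {ss ts} → ss ↭ ts → sizes ss ≡ sizes ts
sizes-↭ {ss} {ts} p = begin
  sizes ss          ≡⟨ sizes≡sum∘map ss ⟩
  sum (map size ss) ≡⟨ sum-↭ (map⁺ size p) ⟩
  sum (map size ts) ≡⟨ sym (sizes≡sum∘map ts) ⟩
  sizes ts          ∎

mutual
  size-shift : ∀ c t → size (shift c t) ≡ size t
  size-shift c (var i A) = refl
  size-shift c (lam ℓ t) = cong suc (size-shift (suc c) t)
  size-shift c (app t ss) = cong suc (cong₂ _+_ (size-shift c t) (sizes-shifts c ss))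

  sizes-shifts : ∀ c ss → sizes (shifts c ss) ≡ sizes ss
  sizes-shifts c [] = refl
  sizes-shifts c (s ∷ ss) = cong₂ _+_ (size-shift c s) (sizes-shifts c ss)

+-interchange-≤ : ∀ {m n} a b c d → m ≤ a + b → n ≤ c + d → m + n ≤ (a + c) + (b + d)
+-interchange-≤ a b c d m≤ n≤ =
  ≤-trans (+-mono-≤ m≤ n≤) (≤-reflexive (interchange a b c d))

mutual
  size-Sub : ∀ {k t ss r} → Sub k t ss r → size r ≤ size t + sizes ss
  size-Sub (sub-here {s = s} _ _) = m≤n⇒m≤1+n (m≤m+n (size s) 0)
  size-Sub (sub-lt _) = ≤-refl
  size-Sub (sub-gt _) = ≤-refl
  size-Sub (sub-lam {t = t} {ss} p) =
    s≤s (≤-trans (size-Sub p) (≤-reflexive (cong (size t +_) (sizes-shifts 0 ss))))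
  size-Sub (sub-app {u = u} {us} {ss} {s0} {sss} perm p ps) =
    s≤s (≤-trans (+-interchange-≤ (size u) (sizes s0) (sizes us) (sizes (concat sss))
                                  (size-Sub p) (sizes-Subs ps))
                 (≤-reflexive (cong (size u + sizes us +_) (begin
                   sizes s0 + sizes (concat sss) ≡⟨ sizes-++ s0 (concat sss) ⟨
                   sizes (concat (s0 ∷ sss))     ≡⟨ sizes-↭ perm ⟨
                   sizes ss                      ∎))))

  sizes-Subs : ∀ {k us sss rs} → Subs k us sss rs → sizes rs ≤ sizes us + sizes (concat sss)
  sizes-Subs [] = z≤n
  sizes-Subs (_∷_ {u = u} {us} {s} {sss} p ps) =
    ≤-trans (+-interchange-≤ (size u) (sizes s) (sizes us) (sizes (concat sss))
                             (size-Sub p) (sizes-Subs ps))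
            (≤-reflexive (cong (size u + sizes us +_) (sym (sizes-++ s (concat sss)))))

mutual
  size-⟶ : ∀ {t u} → t ⟶ u → size u < size t
  size-⟶ (β p) = s≤s (m≤n⇒m≤1+n (size-Sub p))
  size-⟶ (ξlam p) = s≤s (size-⟶ p)
  size-⟶ (ξhead {ss = ss} p) = s≤s (+-monoˡ-< (sizes ss) (size-⟶ p))
  size-⟶ (ξarg {t = t} p) = s≤s (+-monoʳ-< (size t) (sizes-⟶₁ p))

  sizes-⟶₁ : ∀ {ss ss'} → ss ⟶₁ ss' → sizes ss' < sizes ss
  sizes-⟶₁ (here {ss = ss} p) = +-monoˡ-< (sizes ss) (size-⟶ p)
  sizes-⟶₁ (there {s = s} p) = +-monoʳ-< (size s) (sizes-⟶₁ p)

no-infinite-descent : (g : ℕ → ℕ) → ¬ (∀ n → g (suc n) < g n)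
no-infinite-descent g descends = go 0 (<-wellFounded (g 0))
  where
  go : ∀ n → Acc _<_ (g n) → ⊥
  go n (acc rs) = go (suc n) (rs (descends n))

proposition1 : ¬ (Σ (ℕ → Tm) λ f → (∀ n → Correct (f n)) × (∀ n → f n ⟶# f (suc n)))
proposition1 (f , _ , steps) = no-infinite-descent (λ n → size (f n)) size-decreases
  where
  size-decreases : ∀ n → size (f (suc n)) < size (f n)
  size-decreases n with steps n
  ... | _ , _ , step = size-⟶ step
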